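{- Let $n\in\mathbb N$ and $\boldsymbol{c}=(c_1,\ldots,c_{n+1})$ be indeterminates. Then $$\det_{1\le k,\ell\le n}\Big(e_{k-\ell}(\boldsymbol{c})+(-1)^{\ell-1}e_{k+\ell}(\boldsymbol{c})\Big)=\prod_{1\le i<j\le n+1}(1+c_ic_j),$$ where $e_r(\boldsymbol{c})$ is the $r$-th elementary symmetric polynomial in $c_1,\ldots,c_{n+1}$, with $e_0=1$ and $e_r=0$ for $r<0$ or $r>n+1$. -}

module Defs where

open import Level using (Level)
open import Algebra.Bundles using (CommutativeRing)
open import Data.Nat using (ℕ; zero; suc) renaming (_+_ to _+ℕ_)
open import Data.Integer using (ℤ; +_; -[1+_]) renaming (_-_ to _-ℤ_)
open import Data.Fin using (Fin; zero; suc; toℕ; punchIn)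
open import Function using (_∘_)

-- Everything is stated over an arbitrary commutative ring R with the
-- indeterminates c_1..c_{n+1} instantiated by arbitrary elements of R.
-- (A polynomial identity over ℤ holds iff it holds for every commutative
-- ring and every evaluation: take R = ℤ[c_1..c_{n+1}].)
module WithRing {a ℓ : Level} (R : CommutativeRing a ℓ) where
  open CommutativeRing R using (Carrier; _+_; _*_; -_; 0#; 1#)

  sgn : ℕ → Carrier
  sgn zero = 1#
  sgn (suc k) = - sgn k

  sumF : (n : ℕ) → (Fin n → Carrier) → Carrier
  sumF zero f = 0#
  sumF (suc n) f = f zero + sumF n (f ∘ suc)

  prodF : (n : ℕ) → (Fin n → Carrier) → Carrier
  prodF zero f = 1#
  prodF (suc n) f = f zero * prodF n (f ∘ suc)

  det : (n : ℕ) → (Fin n → Fin n → Carrier) → Carrier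
  det zero M = 1#
  det (suc n) M =
    sumF (suc n) (λ j → sgn (toℕ j) * (M zero j * det n (λ i k → M (suc i) (punchIn j k))))

  esym : (m : ℕ) → (Fin m → Carrier) → ℕ → Carrier
  esym m c zero = 1#
  esym zero c (suc r) = 0#
  esym (suc m) c (suc r) = esym m (c ∘ suc) (suc r) + c zero * esym m (c ∘ suc) r

  eℤ : (m : ℕ) → (Fin m → Carrier) → ℤ → Carrier
  eℤ m c (+ r) = esym m c r
  eℤ m c -[1+ r ] = 0#

  -- the matrix (e_{k-ℓ}(c) + (-1)^{ℓ-1} e_{k+ℓ}(c))_{1≤k,ℓ≤n},
  -- with k = toℕ i + 1, ℓ = toℕ j + 1
  theMatrix : (n : ℕ) → (Fin (suc n) → Carrier) → Fin n → Fin n → Carrier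
  theMatrix n c i j =
    eℤ (suc n) c (+ (suc (toℕ i)) -ℤ + (suc (toℕ j)))
      + sgn (toℕ j) * esym (suc n) c (suc (toℕ i) +ℕ suc (toℕ j))

  pairProd : (m : ℕ) → (Fin m → Carrier) → Carrier
  pairProd zero c = 1#
  pairProd (suc m) c =
    prodF m (λ j → 1# + c zero * c (suc j)) * pairProd m (c ∘ suc)

module Submission where

open import Defs
open import Level using (Level)
open import Algebra.Bundles using (CommutativeRing)
open import Data.Nat using (ℕ; suc)
open import Data.Fin using (Fin)

-- Write M_n(c) for `theMatrix n c`.  The theorem follows by induction on n
-- from the recursion
--   det M_{n+1}(c_0, …, c_{n+1}) = Π_{j ≥ 1} (1 + c_0 c_j) · det M_n(c_1, …, c_{n+1}),
-- which compares two evaluations of the determinant of a bordered matrix B of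
-- size n + 2 built from d = (c_1, …, c_{n+1}): column 0 of B is
-- ((-1)^k c_0^k)_k and column j (j ≥ 1) is (e_{k-j}(d) + (-1)^{j-1} e_{k+j}(d))_k,
-- for rows k = 0, …, n + 1.
--   * Adding c_0 · (row k) to row k + 1 for every k clears column 0 and, by
--     Pascal's rule e_r(c) = e_r(d) + c_0 e_{r-1}(d), leaves M_{n+1}(c).
--   * Adding Σ_k (-1)^k e_k(d) · (row k) to row 0 turns it into
--     (Π_j (1 + c_0 d_j), 0, …, 0), by the generating function of the e_k and
--     an alternating orthogonality relation among them; the remaining block has
--     last column (0, …, 0, 1) above which sits M_n(d).

open import Data.Nat using (zero; s≤s)
import Data.Nat as ℕ
import Data.Nat.Properties as ℕₚ
open import Data.Fin using (zero; suc; toℕ; punchIn; inject₁; fromℕ)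
open import Data.Fin.Properties using (toℕ-inject₁; toℕ-fromℕ; toℕ<n)
open import Data.Integer using (_⊖_)
open import Data.Integer.Properties using (m-n≡m⊖n; [1+m]⊖[1+n]≡m⊖n)
open import Function using (_∘_)
import Relation.Binary.PropositionalEquality as ≡
open ≡ using (_≡_)
import Algebra.Solver.Ring.NaturalCoefficients.Default as NatCoefficientSolver

module Proof {a ℓ : Level} (R : CommutativeRing a ℓ) where
  open CommutativeRing R hiding (zero)
  open WithRing R
  open import Algebra.Properties.Ring ring
    using (-‿distribˡ-*; -‿distribʳ-*; -‿involutive; -0#≈0#; +-inverseʳ-unique)
  open import Algebra.Properties.CommutativeSemigroup +-commutativeSemigroup
    using (interchange)
  open import Algebra.Properties.Semiring.Exp semiring using (_^_)
  open NatCoefficientSolver commutativeSemiring using (solve; _:+_; _:*_; _:=_; con)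
  open import Relation.Binary.Reasoning.Setoid setoid

  neg*neg : ∀ x y → - x * - y ≈ x * y
  neg*neg x y = begin
    - x * - y     ≈⟨ -‿distribˡ-* x (- y) ⟨
    - (x * - y)   ≈⟨ -‿cong (-‿distribʳ-* x y) ⟨
    - - (x * y)   ≈⟨ -‿involutive (x * y) ⟩
    x * y         ∎

  neg-cancel : ∀ {u v} → u ≈ v → - u + v ≈ 0#
  neg-cancel {u} {v} u≈v = trans (+-congʳ (-‿cong u≈v)) (-‿inverseˡ v)

  sgn-+ : ∀ k l → sgn (k ℕ.+ l) ≈ sgn k * sgn l
  sgn-+ zero    l = sym (*-identityˡ (sgn l))
  sgn-+ (suc k) l = trans (-‿cong (sgn-+ k l)) (-‿distribˡ-* (sgn k) (sgn l))

  sgn-square : ∀ k → sgn k * sgn k ≈ 1#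
  sgn-square zero    = *-identityˡ 1#
  sgn-square (suc k) = trans (neg*neg (sgn k) (sgn k)) (sgn-square k)

  signs-cancel : ∀ k u v → (sgn k * u) * (sgn k * v) ≈ u * v
  signs-cancel k u v = begin
    (sgn k * u) * (sgn k * v)  ≈⟨ solve 3 (λ s u v → (s :* u) :* (s :* v) := (s :* s) :* (u :* v)) refl (sgn k) u v ⟩
    (sgn k * sgn k) * (u * v)  ≈⟨ *-congʳ (sgn-square k) ⟩
    1# * (u * v)               ≈⟨ *-identityˡ (u * v) ⟩
    u * v                      ∎

  sumF-cong : ∀ n {f g : Fin n → Carrier} → (∀ i → f i ≈ g i) → sumF n f ≈ sumF n g
  sumF-cong zero    f≈g = refl
  sumF-cong (suc n) f≈g = +-cong (f≈g zero) (sumF-cong n (f≈g ∘ suc))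

  sumF-zero : ∀ n {f : Fin n → Carrier} → (∀ i → f i ≈ 0#) → sumF n f ≈ 0#
  sumF-zero zero    f≈0 = refl
  sumF-zero (suc n) f≈0 = trans (+-cong (f≈0 zero) (sumF-zero n (f≈0 ∘ suc))) (+-identityˡ 0#)

  sumF-+ : ∀ n (f g : Fin n → Carrier) → sumF n (λ i → f i + g i) ≈ sumF n f + sumF n g
  sumF-+ zero    f g = sym (+-identityˡ 0#)
  sumF-+ (suc n) f g = trans (+-congˡ (sumF-+ n (f ∘ suc) (g ∘ suc)))
                             (interchange (f zero) (g zero) (sumF n (f ∘ suc)) (sumF n (g ∘ suc)))

  sumF-*ˡ : ∀ n x (f : Fin n → Carrier) → x * sumF n f ≈ sumF n (λ i → x * f i)
  sumF-*ˡ zero    x f = zeroʳ x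
  sumF-*ˡ (suc n) x f = trans (distribˡ x (f zero) (sumF n (f ∘ suc))) (+-congˡ (sumF-*ˡ n x (f ∘ suc)))

  sumF-*ʳ : ∀ n x (f : Fin n → Carrier) → sumF n f * x ≈ sumF n (λ i → f i * x)
  sumF-*ʳ n x f = trans (*-comm (sumF n f) x)
                        (trans (sumF-*ˡ n x f) (sumF-cong n (λ i → *-comm x (f i))))

  sumF-linear : ∀ n b (f g : Fin n → Carrier) →
                sumF n (λ i → f i + b * g i) ≈ sumF n f + b * sumF n g
  sumF-linear n b f g = trans (sumF-+ n f (λ i → b * g i)) (+-congˡ (sym (sumF-*ˡ n b g)))

  sumF-swap : ∀ n m (f : Fin n → Fin m → Carrier) →
              sumF n (λ i → sumF m (f i)) ≈ sumF m (λ j → sumF n (λ i → f i j))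
  sumF-swap zero    m f = sym (sumF-zero m (λ _ → refl))
  sumF-swap (suc n) m f = trans (+-congˡ (sumF-swap n m (f ∘ suc)))
                                (sym (sumF-+ m (f zero) (λ j → sumF n (λ i → f (suc i) j))))

  sumF-last : ∀ n (f : Fin (suc n) → Carrier) → sumF (suc n) f ≈ sumF n (f ∘ inject₁) + f (fromℕ n)
  sumF-last zero    f = trans (+-identityʳ (f zero)) (sym (+-identityˡ (f zero)))
  sumF-last (suc n) f = trans (+-congˡ (sumF-last n (f ∘ suc))) (sym (+-assoc _ _ _))

  sumℕ : ℕ → (ℕ → Carrier) → Carrier
  sumℕ K g = sumF K (g ∘ toℕ)

  sumℕ-split : ∀ K L (g : ℕ → Carrier) → sumℕ (K ℕ.+ L) g ≈ sumℕ K g + sumℕ L (λ k → g (K ℕ.+ k))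
  sumℕ-split zero    L g = sym (+-identityˡ _)
  sumℕ-split (suc K) L g = trans (+-congˡ (sumℕ-split K L (g ∘ suc))) (sym (+-assoc _ _ _))

  sumℕ-last : ∀ K (g : ℕ → Carrier) → sumℕ (suc K) g ≈ sumℕ K g + g K
  sumℕ-last zero    g = trans (+-identityʳ (g 0)) (sym (+-identityˡ (g 0)))
  sumℕ-last (suc K) g = trans (+-congˡ (sumℕ-last K (g ∘ suc))) (sym (+-assoc _ _ _))

  Matrix : ℕ → Set a
  Matrix n = Fin n → Fin n → Carrier

  σ : ∀ {n} → Fin n → Carrier
  σ j = sgn (toℕ j)

  minor : ∀ {n} → Fin (suc n) → Matrix (suc n) → Matrix n
  minor j M i k = M (suc i) (punchIn j k)

  expansionTerm : ∀ n → Matrix (suc n) → Fin (suc n) → Carrier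
  expansionTerm n M j = σ j * (M zero j * det n (minor j M))

  det-cong : ∀ n {M N : Matrix n} → (∀ i j → M i j ≈ N i j) → det n M ≈ det n N
  det-cong zero    M≈N = refl
  det-cong (suc n) M≈N = sumF-cong (suc n) (λ j → *-congˡ {σ j} (*-cong (M≈N zero j)
                           (det-cong n (λ i k → M≈N (suc i) (punchIn j k)))))

  expansionTerm-vanishes : ∀ n (M : Matrix (suc n)) j → det n (minor j M) ≈ 0# → expansionTerm n M j ≈ 0#
  expansionTerm-vanishes n M j minor≈0 =
    trans (*-congˡ {σ j} (trans (*-congˡ minor≈0) (zeroʳ (M zero j)))) (zeroʳ (σ j))

  expansionTerm-vanishes′ : ∀ n (M : Matrix (suc n)) j → M zero j ≈ 0# → expansionTerm n M j ≈ 0#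
  expansionTerm-vanishes′ n M j entry≈0 =
    trans (*-congˡ {σ j} (trans (*-congʳ entry≈0) (zeroˡ (det n (minor j M))))) (zeroʳ (σ j))

  -- Multilinearity: det is linear in each row r.  The rows other than r are
  -- those indexed by `punchIn r`, and they are shared by the three matrices.
  det-linear : ∀ n (r : Fin (suc n)) b (M M₁ M₂ : Matrix (suc n)) →
               (∀ i j → M (punchIn r i) j ≈ M₁ (punchIn r i) j) →
               (∀ i j → M (punchIn r i) j ≈ M₂ (punchIn r i) j) →
               (∀ j → M r j ≈ M₁ r j + b * M₂ r j) →
               det (suc n) M ≈ det (suc n) M₁ + b * det (suc n) M₂

  expansionTerm-linear : ∀ n (r : Fin (suc n)) b (M M₁ M₂ : Matrix (suc n)) →
                         (∀ i j → M (punchIn r i) j ≈ M₁ (punchIn r i) j) →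
                         (∀ i j → M (punchIn r i) j ≈ M₂ (punchIn r i) j) →
                         (∀ j → M r j ≈ M₁ r j + b * M₂ r j) →
                         ∀ j → expansionTerm n M j ≈ expansionTerm n M₁ j + b * expansionTerm n M₂ j

  det-linear n r b M M₁ M₂ rest₁ rest₂ row =
    trans (sumF-cong (suc n) (expansionTerm-linear n r b M M₁ M₂ rest₁ rest₂ row))
          (sumF-linear (suc n) b (expansionTerm n M₁) (expansionTerm n M₂))

  -- Row 0 is the row of the expansion: the minors are common to all three.
  expansionTerm-linear n zero b M M₁ M₂ rest₁ rest₂ row j = begin
    σ j * (M zero j * D)
      ≈⟨ *-congˡ (*-congʳ (row j)) ⟩
    σ j * ((M₁ zero j + b * M₂ zero j) * D)
      ≈⟨ solve 5 (λ s x y b D → s :* ((x :+ b :* y) :* D) := s :* (x :* D) :+ b :* (s :* (y :* D)))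
               refl (σ j) (M₁ zero j) (M₂ zero j) b D ⟩
    σ j * (M₁ zero j * D) + b * (σ j * (M₂ zero j * D))
      ≈⟨ +-cong (*-congˡ (*-congˡ (det-cong n (λ i k → rest₁ i (punchIn j k)))))
                (*-congˡ (*-congˡ (*-congˡ (det-cong n (λ i k → rest₂ i (punchIn j k)))))) ⟩
    expansionTerm n M₁ j + b * expansionTerm n M₂ j ∎
    where
    D : Carrier
    D = det n (minor j M)

  -- A later row: row 0 is common, and the minors are linear in row r.
  expansionTerm-linear (suc n) (suc r) b M M₁ M₂ rest₁ rest₂ row j = begin
    σ j * (M zero j * det (suc n) (minor j M))
      ≈⟨ *-congˡ (*-congˡ (det-linear n r b (minor j M) (minor j M₁) (minor j M₂)
                            (λ i k → rest₁ (suc i) (punchIn j k)) (λ i k → rest₂ (suc i) (punchIn j k))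
                            (λ k → row (punchIn j k)))) ⟩
    σ j * (M zero j * (D₁ + b * D₂))
      ≈⟨ solve 5 (λ s x D₁ D₂ b → s :* (x :* (D₁ :+ b :* D₂)) := s :* (x :* D₁) :+ b :* (s :* (x :* D₂)))
               refl (σ j) (M zero j) D₁ D₂ b ⟩
    σ j * (M zero j * D₁) + b * (σ j * (M zero j * D₂))
      ≈⟨ +-cong (*-congˡ (*-congʳ (rest₁ zero j))) (*-congˡ (*-congˡ (*-congʳ (rest₂ zero j)))) ⟩
    expansionTerm (suc n) M₁ j + b * expansionTerm (suc n) M₂ j ∎
    where
    D₁ D₂ : Carrier
    D₁ = det (suc n) (minor j M₁)
    D₂ = det (suc n) (minor j M₂)

  det-additive : ∀ n (r : Fin (suc n)) (M M₁ M₂ : Matrix (suc n)) →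
                 (∀ i j → M (punchIn r i) j ≈ M₁ (punchIn r i) j) →
                 (∀ i j → M (punchIn r i) j ≈ M₂ (punchIn r i) j) →
                 (∀ j → M r j ≈ M₁ r j + M₂ r j) →
                 det (suc n) M ≈ det (suc n) M₁ + det (suc n) M₂
  det-additive n r M M₁ M₂ rest₁ rest₂ row =
    trans (det-linear n r 1# M M₁ M₂ rest₁ rest₂ (λ j → trans (row j) (+-congˡ (sym (*-identityˡ _)))))
          (+-congˡ (*-identityˡ _))

  -- Alternation.  The basic case is a matrix whose rows 0 and 1 coincide;
  -- expanding along both rows writes det as a sum over ordered pairs of
  -- distinct columns.

  -- A sum over all ordered pairs (j, punchIn j k) of distinct indices of an
  -- antisymmetric function vanishes: the pairs (0, k+1) and (k+1, 0) cancel,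
  -- and the pairs avoiding 0 form the same sum one size down.
  sumPairs-antisymmetric : ∀ m (T : Fin (suc m) → Fin (suc m) → Carrier) →
                           (∀ a b → T a b + T b a ≈ 0#) →
                           sumF (suc m) (λ j → sumF m (λ k → T j (punchIn j k))) ≈ 0#
  sumPairs-antisymmetric zero    T anti = +-identityˡ 0#
  sumPairs-antisymmetric (suc m) T anti = begin
    sumF (suc m) (λ k → T zero (suc k)) +
      sumF (suc m) (λ j → T (suc j) zero + sumF m (λ k → T (suc j) (suc (punchIn j k))))
      ≈⟨ +-congˡ (sumF-+ (suc m) (λ j → T (suc j) zero) (λ j → sumF m (λ k → T (suc j) (suc (punchIn j k))))) ⟩
    sumF (suc m) (λ k → T zero (suc k)) +
      (sumF (suc m) (λ j → T (suc j) zero) + sumF (suc m) (λ j → sumF m (λ k → T (suc j) (suc (punchIn j k)))))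
      ≈⟨ +-congˡ (+-congˡ (sumPairs-antisymmetric m (λ a b → T (suc a) (suc b)) (λ a b → anti (suc a) (suc b)))) ⟩
    sumF (suc m) (λ k → T zero (suc k)) + (sumF (suc m) (λ j → T (suc j) zero) + 0#)
      ≈⟨ +-congˡ (+-identityʳ _) ⟩
    sumF (suc m) (λ k → T zero (suc k)) + sumF (suc m) (λ k → T (suc k) zero)
      ≈⟨ sumF-+ (suc m) (λ k → T zero (suc k)) (λ k → T (suc k) zero) ⟨
    sumF (suc m) (λ k → T zero (suc k) + T (suc k) zero)
      ≈⟨ sumF-zero (suc m) (λ k → anti zero (suc k)) ⟩
    0# ∎

  -- The sign of the pair of columns (a, b) in the double expansion
  -- (its value for a = b is irrelevant).
  pairSign : ∀ {m} → Fin m → Fin m → Carrier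
  pairSign zero    zero    = 0#
  pairSign zero    (suc b) = σ b
  pairSign (suc a) zero    = - σ a
  pairSign (suc a) (suc b) = pairSign a b

  pairSign-punchIn : ∀ {m} (j : Fin (suc m)) (k : Fin m) → pairSign j (punchIn j k) ≈ σ j * σ k
  pairSign-punchIn zero    k       = sym (*-identityˡ (σ k))
  pairSign-punchIn (suc j) zero    = sym (*-identityʳ (- σ j))
  pairSign-punchIn (suc j) (suc k) = trans (pairSign-punchIn j k) (sym (neg*neg (σ j) (σ k)))

  pairSign-antisymmetric : ∀ {m} (a b : Fin m) → pairSign a b + pairSign b a ≈ 0#
  pairSign-antisymmetric zero    zero    = +-identityˡ 0#
  pairSign-antisymmetric zero    (suc b) = -‿inverseʳ (σ b)
  pairSign-antisymmetric (suc a) zero    = -‿inverseˡ (σ a)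
  pairSign-antisymmetric (suc a) (suc b) = pairSign-antisymmetric a b

  -- The increasing enumeration of the columns other than a and b.
  without₂ : ∀ {n} → Fin (suc (suc n)) → Fin (suc (suc n)) → Fin n → Fin (suc (suc n))
  without₂ zero    zero    l = suc (suc l)
  without₂ zero    (suc b) l = suc (punchIn b l)
  without₂ (suc a) zero    l = suc (punchIn a l)
  without₂ {suc n} (suc a) (suc b) zero    = zero
  without₂ {suc n} (suc a) (suc b) (suc l) = suc (without₂ a b l)

  without₂-punchIn : ∀ {n} (j : Fin (suc (suc n))) (k : Fin (suc n)) (l : Fin n) →
                     without₂ j (punchIn j k) l ≡ punchIn j (punchIn k l)
  without₂-punchIn zero    k       l = ≡.refl
  without₂-punchIn (suc j) zero    l = ≡.refl
  without₂-punchIn {suc n} (suc j) (suc k) zero    = ≡.refl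
  without₂-punchIn {suc n} (suc j) (suc k) (suc l) = ≡.cong suc (without₂-punchIn j k l)

  without₂-sym : ∀ {n} (a b : Fin (suc (suc n))) (l : Fin n) → without₂ a b l ≡ without₂ b a l
  without₂-sym zero    zero    l = ≡.refl
  without₂-sym zero    (suc b) l = ≡.refl
  without₂-sym (suc a) zero    l = ≡.refl
  without₂-sym {suc n} (suc a) (suc b) zero    = ≡.refl
  without₂-sym {suc n} (suc a) (suc b) (suc l) = ≡.cong suc (without₂-sym a b l)

  pairTerm : ∀ n → Matrix (suc (suc n)) → Fin (suc (suc n)) → Fin (suc (suc n)) → Carrier
  pairTerm n M a b = pairSign a b * (M zero a * (M (suc zero) b * det n (λ i l → M (suc (suc i)) (without₂ a b l))))

  -- Laplace expansion along rows 0 and 1: expand along row 0, then each minor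
  -- along its own row 0.
  det-double-expansion : ∀ n (M : Matrix (suc (suc n))) →
                         det (suc (suc n)) M ≈ sumF (suc (suc n)) (λ j → sumF (suc n) (λ k → pairTerm n M j (punchIn j k)))
  det-double-expansion n M = sumF-cong (suc (suc n)) expand
    where
    expand : ∀ j → expansionTerm (suc n) M j ≈ sumF (suc n) (λ k → pairTerm n M j (punchIn j k))
    expand j = begin
      σ j * (M zero j * sumF (suc n) (λ k → σ k * (M (suc zero) (punchIn j k) * X k)))
        ≈⟨ *-congˡ {σ j} (sumF-*ˡ (suc n) (M zero j) (λ k → σ k * (M (suc zero) (punchIn j k) * X k))) ⟩
      σ j * sumF (suc n) (λ k → M zero j * (σ k * (M (suc zero) (punchIn j k) * X k)))
        ≈⟨ sumF-*ˡ (suc n) (σ j) (λ k → M zero j * (σ k * (M (suc zero) (punchIn j k) * X k))) ⟩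
      sumF (suc n) (λ k → σ j * (M zero j * (σ k * (M (suc zero) (punchIn j k) * X k))))
        ≈⟨ sumF-cong (suc n) term ⟩
      sumF (suc n) (λ k → pairTerm n M j (punchIn j k)) ∎
      where
      X : Fin (suc n) → Carrier
      X k = det n (minor k (minor j M))
      term : ∀ k → σ j * (M zero j * (σ k * (M (suc zero) (punchIn j k) * X k))) ≈ pairTerm n M j (punchIn j k)
      term k = begin
        σ j * (M zero j * (σ k * (M (suc zero) (punchIn j k) * X k)))
          ≈⟨ solve 5 (λ a b c d e → a :* (b :* (c :* (d :* e))) := (a :* c) :* (b :* (d :* e)))
                   refl (σ j) (M zero j) (σ k) (M (suc zero) (punchIn j k)) (X k) ⟩
        (σ j * σ k) * (M zero j * (M (suc zero) (punchIn j k) * X k))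
          ≈⟨ *-cong (sym (pairSign-punchIn j k)) (*-congˡ (*-congˡ
               (det-cong n (λ i l → reflexive (≡.cong (M (suc (suc i))) (≡.sym (without₂-punchIn j k l))))))) ⟩
        pairTerm n M j (punchIn j k) ∎

  -- A matrix whose rows 0 and 1 coincide has determinant zero: in the double
  -- expansion the pairs (a, b) and (b, a) cancel.
  det-equal-rows01 : ∀ n (M : Matrix (suc (suc n))) → (∀ j → M (suc zero) j ≈ M zero j) →
                     det (suc (suc n)) M ≈ 0#
  det-equal-rows01 n M row₁≈row₀ =
    trans (det-double-expansion n M) (sumPairs-antisymmetric (suc n) (pairTerm n M) antisymmetric)
    where
    N : Fin (suc (suc n)) → Fin (suc (suc n)) → Carrier
    N a b = det n (λ i l → M (suc (suc i)) (without₂ a b l))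
    antisymmetric : ∀ a b → pairTerm n M a b + pairTerm n M b a ≈ 0#
    antisymmetric a b = begin
      pairSign a b * (M zero a * (M (suc zero) b * N a b)) + pairSign b a * (M zero b * (M (suc zero) a * N b a))
        ≈⟨ +-cong (*-congˡ {pairSign a b} (*-congˡ (*-congʳ (row₁≈row₀ b))))
                  (*-congˡ {pairSign b a} (*-congˡ (*-cong (row₁≈row₀ a)
                    (det-cong n (λ i l → reflexive (≡.cong (M (suc (suc i))) (without₂-sym b a l))))))) ⟩
      pairSign a b * (u a * (u b * N a b)) + pairSign b a * (u b * (u a * N a b))
        ≈⟨ solve 5 (λ e f x y D → e :* (x :* (y :* D)) :+ f :* (y :* (x :* D)) := (e :+ f) :* (x :* (y :* D)))
                 refl (pairSign a b) (pairSign b a) (u a) (u b) (N a b) ⟩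
      (pairSign a b + pairSign b a) * (u a * (u b * N a b))
        ≈⟨ *-congʳ (pairSign-antisymmetric a b) ⟩
      0# * (u a * (u b * N a b))
        ≈⟨ zeroˡ _ ⟩
      0# ∎
      where
      u : Fin (suc (suc n)) → Carrier
      u = M zero

  withRows01 : ∀ {n} → (u v : Fin (suc (suc n)) → Carrier) → Matrix (suc (suc n)) → Matrix (suc (suc n))
  withRows01 u v M zero          = u
  withRows01 u v M (suc zero)    = v
  withRows01 u v M (suc (suc i)) = M (suc (suc i))

  -- Exchanging rows 0 and 1 negates det: with w = u + v, multilinearity gives
  -- 0 = D(w, w) = D(u, u) + D(u, v) + D(v, u) + D(v, v) = D(u, v) + D(v, u).
  det-swap01 : ∀ n (M M' : Matrix (suc (suc n))) →
               (∀ j → M' zero j ≈ M (suc zero) j) → (∀ j → M' (suc zero) j ≈ M zero j) →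
               (∀ i j → M' (suc (suc i)) j ≈ M (suc (suc i)) j) →
               det (suc (suc n)) M' ≈ - det (suc (suc n)) M
  det-swap01 n M M' row₀ row₁ rest = +-inverseʳ-unique (det (suc (suc n)) M) (det (suc (suc n)) M') (begin
    det (suc (suc n)) M + det (suc (suc n)) M'
      ≈⟨ +-cong (det-cong (suc (suc n)) original) (det-cong (suc (suc n)) swapped) ⟩
    D u v + D v u                 ≈⟨ +-cong (+-identityˡ (D u v)) (+-identityʳ (D v u)) ⟨
    (0# + D u v) + (D v u + 0#)   ≈⟨ +-cong (+-congʳ (D-diagonal u)) (+-congˡ (D-diagonal v)) ⟨
    (D u u + D u v) + (D v u + D v v)
      ≈⟨ +-cong (expand₁ u) (expand₁ v) ⟨
    D u w + D v w
      ≈⟨ det-additive (suc n) zero (rows w w) (rows u w) (rows v w)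
           (λ { zero j → refl ; (suc i) j → refl }) (λ { zero j → refl ; (suc i) j → refl }) (λ j → refl) ⟨
    D w w                         ≈⟨ D-diagonal w ⟩
    0# ∎)
    where
    u v w : Fin (suc (suc n)) → Carrier
    u = M zero
    v = M (suc zero)
    w j = u j + v j
    rows : (Fin (suc (suc n)) → Carrier) → (Fin (suc (suc n)) → Carrier) → Matrix (suc (suc n))
    rows x y = withRows01 x y M
    D : (Fin (suc (suc n)) → Carrier) → (Fin (suc (suc n)) → Carrier) → Carrier
    D x y = det (suc (suc n)) (rows x y)
    D-diagonal : ∀ x → D x x ≈ 0#
    D-diagonal x = det-equal-rows01 n (rows x x) (λ j → refl)
    expand₁ : ∀ x → D x w ≈ D x u + D x v
    expand₁ x = det-additive (suc n) (suc zero) (rows x w) (rows x u) (rows x v)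
                  (λ { zero j → refl ; (suc i) j → refl }) (λ { zero j → refl ; (suc i) j → refl }) (λ j → refl)
    original : ∀ i j → M i j ≈ rows u v i j
    original zero          j = refl
    original (suc zero)    j = refl
    original (suc (suc i)) j = refl
    swapped : ∀ i j → M' i j ≈ rows v u i j
    swapped zero          j = row₀ j
    swapped (suc zero)    j = row₁ j
    swapped (suc (suc i)) j = rest i j

  -- If row k+1 repeats row 0 then det vanishes: for k = 0 this is
  -- `det-equal-rows01`; otherwise exchange rows 0 and 1, after which in every
  -- minor along row 0 the row k repeats the row 0.
  det-repeated-row : ∀ n (k : Fin (suc n)) (M : Matrix (suc (suc n))) →
                     (∀ j → M (suc k) j ≈ M zero j) → det (suc (suc n)) M ≈ 0#
  det-repeated-row n       zero    M repeated = det-equal-rows01 n M repeated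
  det-repeated-row (suc n) (suc k) M repeated = begin
    det (suc (suc (suc n))) M
      ≈⟨ det-swap01 (suc n) M' M (λ j → refl) (λ j → refl) (λ i j → refl) ⟩
    - det (suc (suc (suc n))) M'
      ≈⟨ -‿cong (sumF-zero (suc (suc (suc n))) (λ j →
           expansionTerm-vanishes (suc (suc n)) M' j (det-repeated-row n k (minor j M') (λ l → repeated (punchIn j l))))) ⟩
    - 0#
      ≈⟨ -0#≈0# ⟩
    0# ∎
    where
    M' : Matrix (suc (suc (suc n)))
    M' = withRows01 (M (suc zero)) (M zero) M

  withRow0 : ∀ {n} → (Fin (suc n) → Carrier) → Matrix (suc n) → Matrix (suc n)
  withRow0 v M zero    = v
  withRow0 v M (suc i) = M (suc i)

  det-add-combination : ∀ n (y : Fin n → Carrier) (M M' : Matrix (suc n)) →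
                        (∀ j → M' zero j ≈ M zero j + sumF n (λ k → y k * M (suc k) j)) →
                        (∀ i j → M' (suc i) j ≈ M (suc i) j) →
                        det (suc n) M' ≈ det (suc n) M
  det-add-combination n y M M' row₀ rest = begin
    det (suc n) M'
      ≈⟨ det-additive n zero M' M (withRow0 combination M) rest rest row₀ ⟩
    det (suc n) M + det (suc n) (withRow0 combination M)
      ≈⟨ +-congˡ combination-vanishes ⟩
    det (suc n) M + 0#
      ≈⟨ +-identityʳ _ ⟩
    det (suc n) M ∎
    where
    combination : Fin (suc n) → Carrier
    combination j = sumF n (λ k → y k * M (suc k) j)
    D : Fin (suc n) → Carrier
    D j = det n (minor j M)
    repeats : ∀ {n} (k : Fin n) (N : Matrix (suc n)) → det (suc n) (withRow0 (N (suc k)) N) ≈ 0#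
    repeats {suc n} k N = det-repeated-row n k (withRow0 (N (suc k)) N) (λ j → refl)
    combination-vanishes : det (suc n) (withRow0 combination M) ≈ 0#
    combination-vanishes = begin
      sumF (suc n) (λ j → σ j * (combination j * D j))
        ≈⟨ sumF-cong (suc n) (λ j → trans (*-congˡ {σ j} (sumF-*ʳ n (D j) (λ k → y k * M (suc k) j)))
             (trans (sumF-*ˡ n (σ j) (λ k → y k * M (suc k) j * D j))
               (sumF-cong n (λ k → solve 4 (λ s y x D → s :* (y :* x :* D) := y :* (s :* (x :* D)))
                                       refl (σ j) (y k) (M (suc k) j) (D j))))) ⟩
      sumF (suc n) (λ j → sumF n (λ k → y k * (σ j * (M (suc k) j * D j))))
        ≈⟨ sumF-swap (suc n) n (λ j k → y k * (σ j * (M (suc k) j * D j))) ⟩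
      sumF n (λ k → sumF (suc n) (λ j → y k * (σ j * (M (suc k) j * D j))))
        ≈⟨ sumF-cong n (λ k → trans (sym (sumF-*ˡ (suc n) (y k) (λ j → σ j * (M (suc k) j * D j))))
                                    (trans (*-congˡ {y k} (repeats k M)) (zeroʳ (y k)))) ⟩
      sumF n (λ k → 0#)
        ≈⟨ sumF-zero n (λ k → refl) ⟩
      0# ∎

  -- Each minor along row 0 undergoes the
  -- same operation after its own row 0 is split by linearity; the split-off
  -- parts assemble into a determinant with rows 0 and 1 equal.
  det-add-previous-rows : ∀ n b (M M' : Matrix (suc n)) →
                          (∀ j → M' zero j ≈ M zero j) →
                          (∀ i j → M' (suc i) j ≈ M (suc i) j + b * M (inject₁ i) j) →
                          det (suc n) M' ≈ det (suc n) M
  det-add-previous-rows zero    b M M' row₀ rows = det-cong 1 {M'} {M} (λ { zero j → row₀ j })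
  det-add-previous-rows (suc n) b M M' row₀ rows = begin
    det (suc (suc n)) M'
      ≈⟨ sumF-cong (suc (suc n)) term ⟩
    sumF (suc (suc n)) (λ j → expansionTerm (suc n) M j + b * expansionTerm (suc n) Y j)
      ≈⟨ sumF-linear (suc (suc n)) b (expansionTerm (suc n) M) (expansionTerm (suc n) Y) ⟩
    det (suc (suc n)) M + b * det (suc (suc n)) Y
      ≈⟨ +-congˡ (*-congˡ (det-equal-rows01 n Y (λ j → refl))) ⟩
    det (suc (suc n)) M + b * 0#
      ≈⟨ +-congˡ (zeroʳ b) ⟩
    det (suc (suc n)) M + 0#
      ≈⟨ +-identityʳ _ ⟩
    det (suc (suc n)) M ∎
    where
    Y : Matrix (suc (suc n))
    Y = withRows01 (M zero) (M zero) M'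
    -- minor j M' = P + b·(minor j Y) in its row 0, where P is minor j M
    -- after the row operation
    term : ∀ j → expansionTerm (suc n) M' j ≈ expansionTerm (suc n) M j + b * expansionTerm (suc n) Y j
    term j = begin
      σ j * (M' zero j * det (suc n) (minor j M'))
        ≈⟨ *-congˡ {σ j} (*-cong (row₀ j)
             (det-linear n zero b (minor j M') P (minor j Y) (λ i k → refl) (λ i k → refl)
                         (λ k → rows zero (punchIn j k)))) ⟩
      σ j * (M zero j * (det (suc n) P + b * det (suc n) (minor j Y)))
        ≈⟨ *-congˡ {σ j} (*-congˡ (+-congʳ
             (det-add-previous-rows n b (minor j M) P (λ k → refl) (λ i k → rows (suc i) (punchIn j k))))) ⟩
      σ j * (M zero j * (det (suc n) (minor j M) + b * det (suc n) (minor j Y)))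
        ≈⟨ solve 5 (λ s x D E b → s :* (x :* (D :+ b :* E)) := s :* (x :* D) :+ b :* (s :* (x :* E)))
                 refl (σ j) (M zero j) (det (suc n) (minor j M)) (det (suc n) (minor j Y)) b ⟩
      expansionTerm (suc n) M j + b * expansionTerm (suc n) Y j ∎
      where
      P : Matrix (suc n)
      P = withRow0 (λ k → M (suc zero) (punchIn j k)) (minor j M')

  det-leading-term : ∀ n (M : Matrix (suc n)) → (∀ j → expansionTerm n M (suc j) ≈ 0#) →
                     det (suc n) M ≈ M zero zero * det n (minor zero M)
  det-leading-term n M rest≈0 = begin
    1# * (M zero zero * det n (minor zero M)) + sumF n (λ j → expansionTerm n M (suc j))
      ≈⟨ +-cong (*-identityˡ _) (sumF-zero n rest≈0) ⟩
    M zero zero * det n (minor zero M) + 0#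
      ≈⟨ +-identityʳ _ ⟩
    M zero zero * det n (minor zero M) ∎

  det-zero-column : ∀ n (M : Matrix (suc n)) → (∀ i → M i zero ≈ 0#) → det (suc n) M ≈ 0#

  det-first-column : ∀ n (M : Matrix (suc n)) → (∀ i → M (suc i) zero ≈ 0#) →
                     det (suc n) M ≈ M zero zero * det n (minor zero M)

  det-zero-column n M column≈0 = begin
    det (suc n) M                        ≈⟨ det-first-column n M (column≈0 ∘ suc) ⟩
    M zero zero * det n (minor zero M)   ≈⟨ *-congʳ (column≈0 zero) ⟩
    0# * det n (minor zero M)            ≈⟨ zeroˡ _ ⟩
    0# ∎

  det-first-column zero    M column≈0 = det-leading-term zero M (λ ())
  det-first-column (suc n) M column≈0 = det-leading-term (suc n) M (λ j →
    expansionTerm-vanishes (suc n) M (suc j) (det-zero-column n (minor (suc j) M) column≈0))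

  det-first-row : ∀ n (M : Matrix (suc n)) → (∀ j → M zero (suc j) ≈ 0#) →
                  det (suc n) M ≈ M zero zero * det n (minor zero M)
  det-first-row n M row≈0 = det-leading-term n M (λ j → expansionTerm-vanishes′ n M (suc j) (row≈0 j))

  punchIn-inject₁ : ∀ {n} (j : Fin (suc n)) (k : Fin n) → punchIn (inject₁ j) (inject₁ k) ≡ inject₁ (punchIn j k)
  punchIn-inject₁ zero    k       = ≡.refl
  punchIn-inject₁ (suc j) zero    = ≡.refl
  punchIn-inject₁ (suc j) (suc k) = ≡.cong suc (punchIn-inject₁ j k)

  punchIn-fromℕ : ∀ {n} (j : Fin (suc n)) → punchIn (inject₁ j) (fromℕ n) ≡ fromℕ (suc n)
  punchIn-fromℕ         zero    = ≡.refl
  punchIn-fromℕ {suc n} (suc j) = ≡.cong suc (punchIn-fromℕ j)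

  -- A last column (0, …, 0, 1) gives det = det of the upper-left block.
  -- The last expansion term vanishes and the others are, by induction, the
  -- terms of the expansion of the upper-left block.
  det-last-column : ∀ n (M : Matrix (suc n)) →
                    (∀ i → M (inject₁ i) (fromℕ n) ≈ 0#) → M (fromℕ n) (fromℕ n) ≈ 1# →
                    det (suc n) M ≈ det n (λ i k → M (inject₁ i) (inject₁ k))
  det-last-column zero    M column≈0 corner≈1 =
    trans (+-identityʳ _) (trans (*-identityˡ _) (trans (*-identityʳ _) corner≈1))
  det-last-column (suc n) M column≈0 corner≈1 = begin
    det (suc (suc n)) M
      ≈⟨ sumF-last (suc n) (expansionTerm (suc n) M) ⟩
    sumF (suc n) (expansionTerm (suc n) M ∘ inject₁) + expansionTerm (suc n) M (fromℕ (suc n))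
      ≈⟨ +-cong (sumF-cong (suc n) term) (expansionTerm-vanishes′ (suc n) M (fromℕ (suc n)) (column≈0 zero)) ⟩
    det (suc n) B + 0#
      ≈⟨ +-identityʳ _ ⟩
    det (suc n) B ∎
    where
    B : Matrix (suc n)
    B i k = M (inject₁ i) (inject₁ k)
    term : ∀ j → expansionTerm (suc n) M (inject₁ j) ≈ expansionTerm n B j
    term j = *-cong (reflexive (≡.cong sgn (toℕ-inject₁ j))) (*-congˡ (begin
      det (suc n) (minor (inject₁ j) M)
        ≈⟨ det-last-column n (minor (inject₁ j) M)
             (λ i → trans (reflexive (≡.cong (M (suc (inject₁ i))) (punchIn-fromℕ j))) (column≈0 (suc i)))
             (trans (reflexive (≡.cong (M (suc (fromℕ n))) (punchIn-fromℕ j))) corner≈1) ⟩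
      det n (λ i k → M (suc (inject₁ i)) (punchIn (inject₁ j) (inject₁ k)))
        ≈⟨ det-cong n (λ i k → reflexive (≡.cong (M (suc (inject₁ i))) (punchIn-inject₁ j k))) ⟩
      det n (minor j B) ∎))

  esym-vanishes : ∀ m (d : Fin m → Carrier) {r} → m ℕ.< r → esym m d r ≈ 0#
  esym-vanishes zero    d {suc r} _           = refl
  esym-vanishes (suc m) d {suc r} (s≤s m<r) = begin
    esym m (d ∘ suc) (suc r) + d zero * esym m (d ∘ suc) r
      ≈⟨ +-cong (esym-vanishes m (d ∘ suc) (ℕₚ.m<n⇒m<1+n m<r)) (*-congˡ (esym-vanishes m (d ∘ suc) m<r)) ⟩
    0# + d zero * 0#
      ≈⟨ trans (+-identityˡ _) (zeroʳ (d zero)) ⟩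
    0# ∎

  -- Peeling off d_0,
  -- e_{k+1}(d) = e_{k+1}(d') + d_0 e_k(d') turns the sum into (1 + x d_0) times
  -- the sum for d' = (d_1, …, d_{m-1}).
  esym-generating : ∀ x m (d : Fin m → Carrier) →
                    sumℕ (suc m) (λ k → esym m d k * x ^ k) ≈ prodF m (λ j → 1# + x * d j)
  esym-generating x zero    d = trans (+-identityʳ (1# * 1#)) (*-identityˡ 1#)
  esym-generating x (suc m) d = begin
    1# * 1# + sumℕ (suc m) (λ k → (e (suc k) + d₀ * e k) * (x * x ^ k))
      ≈⟨ +-congˡ (sumF-cong (suc m) (λ k → solve 5
           (λ A B d₀ x p → (A :+ d₀ :* B) :* (x :* p) := A :* (x :* p) :+ (d₀ :* x) :* (B :* p))
           refl (e (suc (toℕ k))) (e (toℕ k)) d₀ x (x ^ toℕ k))) ⟩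
    1# * 1# + sumℕ (suc m) (λ k → e (suc k) * (x * x ^ k) + (d₀ * x) * (e k * x ^ k))
      ≈⟨ +-congˡ (sumF-linear (suc m) (d₀ * x) (λ k → e (suc (toℕ k)) * x ^ suc (toℕ k))
                                              (λ k → e (toℕ k) * x ^ toℕ k)) ⟩
    1# * 1# + (sumℕ (suc m) (λ k → e (suc k) * x ^ suc k) + (d₀ * x) * E)
      ≈⟨ +-assoc _ _ _ ⟨
    sumℕ (suc (suc m)) (λ k → e k * x ^ k) + (d₀ * x) * E
      ≈⟨ +-congʳ (trans (sumℕ-last (suc m) (λ k → e k * x ^ k)) (+-congˡ top-term-vanishes)) ⟩
    (E + 0#) + (d₀ * x) * E
      ≈⟨ solve 3 (λ E d₀ x → (E :+ con 0) :+ (d₀ :* x) :* E := (con 1 :+ x :* d₀) :* E) refl E d₀ x ⟩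
    (1# + x * d₀) * E
      ≈⟨ *-congˡ (esym-generating x m (d ∘ suc)) ⟩
    prodF (suc m) (λ j → 1# + x * d j) ∎
    where
    e : ℕ → Carrier
    e = esym m (d ∘ suc)
    d₀ : Carrier
    d₀ = d zero
    E : Carrier
    E = sumℕ (suc m) (λ k → e k * x ^ k)
    top-term-vanishes : e (suc m) * x ^ suc m ≈ 0#
    top-term-vanishes = trans (*-congʳ (esym-vanishes m (d ∘ suc) (ℕₚ.n<1+n m))) (zeroˡ _)

  eDiff : ∀ m → (Fin m → Carrier) → ℕ → ℕ → Carrier
  eDiff m d k       zero    = esym m d k
  eDiff m d zero    (suc l) = 0#
  eDiff m d (suc k) (suc l) = eDiff m d k l

  eℤ-⊖ : ∀ m d k l → eℤ m d (k ⊖ l) ≡ eDiff m d k l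
  eℤ-⊖ m d k       zero    = ≡.refl
  eℤ-⊖ m d zero    (suc l) = ≡.refl
  eℤ-⊖ m d (suc k) (suc l) = ≡.trans (≡.cong (eℤ m d) ([1+m]⊖[1+n]≡m⊖n k l)) (eℤ-⊖ m d k l)

  eDiff-below : ∀ m d {k l} → k ℕ.< l → eDiff m d k l ≡ 0#
  eDiff-below m d {zero}  {suc l} _         = ≡.refl
  eDiff-below m d {suc k} {suc l} (s≤s k<l) = eDiff-below m d k<l

  eDiff-shift : ∀ m d l k → eDiff m d (l ℕ.+ k) l ≡ esym m d k
  eDiff-shift m d zero    k = ≡.refl
  eDiff-shift m d (suc l) k = eDiff-shift m d l k

  eDiff-diagonal : ∀ m d l → eDiff m d l l ≡ 1#
  eDiff-diagonal m d zero    = ≡.refl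
  eDiff-diagonal m d (suc l) = eDiff-diagonal m d l

  eDiff-step : ∀ m (d : Fin (suc m) → Carrier) k l →
               eDiff (suc m) d k l ≈ eDiff m (d ∘ suc) k l + d zero * eDiff m (d ∘ suc) k (suc l)
  eDiff-step m d zero    zero    = sym (trans (+-congˡ (zeroʳ (d zero))) (+-identityʳ 1#))
  eDiff-step m d (suc k) zero    = refl
  eDiff-step m d zero    (suc l) = sym (trans (+-congˡ (zeroʳ (d zero))) (+-identityʳ 0#))
  eDiff-step m d (suc k) (suc l) = eDiff-step m d k l

  -- e_{k-j-1}(d) + (-1)^j e_{k+j+1}(d): for k ≥ 1 the (k, j+1) entry of the
  -- matrix of the theorem, and the entry in row k and column j+1 of the
  -- bordered matrix used below.
  entry : ∀ m → (Fin m → Carrier) → ℕ → ℕ → Carrier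
  entry m d k j = eDiff m d k (suc j) + sgn j * esym m d (k ℕ.+ suc j)

  theMatrix-entry : ∀ n c (i j : Fin n) → theMatrix n c i j ≈ entry (suc n) c (suc (toℕ i)) (toℕ j)
  theMatrix-entry n c i j = +-congʳ (reflexive (≡.trans
    (≡.cong (eℤ (suc n) c) (m-n≡m⊖n (suc (toℕ i)) (suc (toℕ j))))
    (eℤ-⊖ (suc n) c (suc (toℕ i)) (suc (toℕ j)))))

  entry-step : ∀ m (d : Fin (suc m) → Carrier) k j →
               entry (suc m) d (suc k) j ≈ entry m (d ∘ suc) (suc k) j + d zero * entry m (d ∘ suc) k j
  entry-step m d k j = trans (+-congʳ (eDiff-step m d k j))
    (solve 6 (λ X Y s P Q x → (X :+ x :* Y) :+ s :* (P :+ x :* Q) := (X :+ s :* P) :+ x :* (Y :+ s :* Q))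
       refl (eDiff m (d ∘ suc) k j) (eDiff m (d ∘ suc) k (suc j)) (sgn j)
            (esym m (d ∘ suc) (suc k ℕ.+ suc j)) (esym m (d ∘ suc) (k ℕ.+ suc j)) (d zero))

  entry-above : ∀ m d {k j} → k ℕ.≤ j → m ℕ.< k ℕ.+ suc j → entry m d k j ≈ 0#
  entry-above m d {k} {j} k≤j m<k+j+1 = begin
    eDiff m d k (suc j) + sgn j * esym m d (k ℕ.+ suc j)
      ≈⟨ +-cong (reflexive (eDiff-below m d (s≤s k≤j))) (*-congˡ (esym-vanishes m d m<k+j+1)) ⟩
    0# + sgn j * 0#
      ≈⟨ trans (+-identityˡ _) (zeroʳ (sgn j)) ⟩
    0# ∎

  entry-diagonal : ∀ j (d : Fin (suc j) → Carrier) → entry (suc j) d (suc j) j ≈ 1#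
  entry-diagonal j d = begin
    eDiff (suc j) d j j + sgn j * esym (suc j) d (suc j ℕ.+ suc j)
      ≈⟨ +-cong (reflexive (eDiff-diagonal (suc j) d j))
                (*-congˡ (esym-vanishes (suc j) d (s≤s (ℕₚ.m≤n+m (suc j) j)))) ⟩
    1# + sgn j * 0#
      ≈⟨ trans (+-congˡ (zeroʳ (sgn j))) (+-identityʳ 1#) ⟩
    1# ∎

  -- Σ_{t ≤ m} g_t e_{t-l}(d) = Σ_{k ≤ m} g_{l+k} e_k(d) when g vanishes beyond m:
  -- the terms with t < l are zero, and completing the range to t < m + 1 + l
  -- adds only zeros.
  eDiff-reindex : ∀ m (d : Fin m → Carrier) l (g : ℕ → Carrier) → (∀ t → g (suc m ℕ.+ t) ≈ 0#) →
                  sumℕ (suc m) (λ t → g t * eDiff m d t l) ≈ sumℕ (suc m) (λ k → g (l ℕ.+ k) * esym m d k)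
  eDiff-reindex m d l g g-vanishes = begin
    sumℕ (suc m) shifted
      ≈⟨ trans (+-congˡ (sumF-zero l beyond-m)) (+-identityʳ _) ⟨
    sumℕ (suc m) shifted + sumℕ l (λ t → shifted (suc m ℕ.+ t))
      ≈⟨ sumℕ-split (suc m) l shifted ⟨
    sumℕ (suc m ℕ.+ l) shifted
      ≡⟨ ≡.cong (λ K → sumℕ K shifted) (ℕₚ.+-comm (suc m) l) ⟩
    sumℕ (l ℕ.+ suc m) shifted
      ≈⟨ sumℕ-split l (suc m) shifted ⟩
    sumℕ l shifted + sumℕ (suc m) (λ k → shifted (l ℕ.+ k))
      ≈⟨ +-cong (sumF-zero l below-l)
                (sumF-cong (suc m) (λ k → *-congˡ {g (l ℕ.+ toℕ k)} (reflexive (eDiff-shift m d l (toℕ k))))) ⟩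
    0# + sumℕ (suc m) (λ k → g (l ℕ.+ k) * esym m d k)
      ≈⟨ +-identityˡ _ ⟩
    sumℕ (suc m) (λ k → g (l ℕ.+ k) * esym m d k) ∎
    where
    shifted : ℕ → Carrier
    shifted t = g t * eDiff m d t l
    beyond-m : ∀ (t : Fin l) → shifted (suc m ℕ.+ toℕ t) ≈ 0#
    beyond-m t = trans (*-congʳ (g-vanishes (toℕ t))) (zeroˡ _)
    below-l : ∀ (t : Fin l) → shifted (toℕ t) ≈ 0#
    below-l t = trans (*-congˡ (reflexive (eDiff-below m d (toℕ<n t)))) (zeroʳ _)

  -- Shifting t ↦ t + j + 1 in the e_{t-j-1} part, the
  -- two parts cancel termwise, since (-1)^{k+j+1} = -(-1)^j (-1)^k.
  esym-annihilates : ∀ m (d : Fin m → Carrier) j →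
                     sumℕ (suc m) (λ t → (sgn t * esym m d t) * entry m d t j) ≈ 0#
  esym-annihilates m d j = begin
    sumℕ (suc m) (λ t → G t * (eDiff m d t L + sgn j * e (t ℕ.+ L)))
      ≈⟨ sumF-cong (suc m) (λ t → distribˡ (G (toℕ t)) (eDiff m d (toℕ t) L) (sgn j * e (toℕ t ℕ.+ L))) ⟩
    sumℕ (suc m) (λ t → G t * eDiff m d t L + direct t)
      ≈⟨ sumF-+ (suc m) (λ t → G (toℕ t) * eDiff m d (toℕ t) L) (direct ∘ toℕ) ⟩
    sumℕ (suc m) (λ t → G t * eDiff m d t L) + sumℕ (suc m) direct
      ≈⟨ +-congʳ (eDiff-reindex m d L G G-vanishes) ⟩
    sumℕ (suc m) (λ k → G (L ℕ.+ k) * e k) + sumℕ (suc m) direct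
      ≈⟨ sumF-+ (suc m) (λ k → G (L ℕ.+ toℕ k) * e (toℕ k)) (direct ∘ toℕ) ⟨
    sumℕ (suc m) (λ k → G (L ℕ.+ k) * e k + direct k)
      ≈⟨ sumF-zero (suc m) (cancel ∘ toℕ) ⟩
    0# ∎
    where
    e : ℕ → Carrier
    e = esym m d
    L : ℕ
    L = suc j
    G : ℕ → Carrier
    G t = sgn t * e t
    G-vanishes : ∀ t → G (suc m ℕ.+ t) ≈ 0#
    G-vanishes t = trans (*-congˡ (esym-vanishes m d (s≤s (ℕₚ.m≤m+n m t)))) (zeroʳ _)
    direct : ℕ → Carrier
    direct t = G t * (sgn j * e (t ℕ.+ L))

    cancel : ∀ k → G (L ℕ.+ k) * e k + direct k ≈ 0#
    cancel k = begin
      (- sgn (j ℕ.+ k) * e (L ℕ.+ k)) * e k + (sgn k * e k) * (sgn j * e (k ℕ.+ L))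
        ≈⟨ +-cong (*-congʳ (*-congʳ (-‿cong (sgn-+ j k))))
                  (*-congˡ (*-congˡ (reflexive (≡.cong e (ℕₚ.+-comm k L))))) ⟩
      (- (sgn j * sgn k) * e (L ℕ.+ k)) * e k + (sgn k * e k) * (sgn j * e (L ℕ.+ k))
        ≈⟨ +-congʳ (trans (*-congʳ (sym (-‿distribˡ-* _ _))) (sym (-‿distribˡ-* _ _))) ⟩
      - ((sgn j * sgn k) * e (L ℕ.+ k) * e k) + (sgn k * e k) * (sgn j * e (L ℕ.+ k))
        ≈⟨ neg-cancel (solve 4 (λ a b F x → (a :* b) :* F :* x := (b :* x) :* (a :* F))
                             refl (sgn j) (sgn k) (e (L ℕ.+ k)) (e k)) ⟩
      0# ∎

  bordered : ∀ m → (Fin (suc m) → Carrier) → Matrix (suc m)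
  bordered m c k zero    = sgn (toℕ k) * c zero ^ toℕ k
  bordered m c k (suc j) = entry m (c ∘ suc) (toℕ k) (toℕ j)

  -- Adding c_0 times each row to the next clears column 0 below the corner 1
  -- and, by Pascal's rule, turns the remaining block into the matrix of the
  -- theorem for all of c.
  bordered-det-shift : ∀ m (c : Fin (suc m) → Carrier) →
                       det (suc m) (bordered m c) ≈ det m (theMatrix m c)
  bordered-det-shift m c = begin
    det (suc m) D
      ≈⟨ det-add-previous-rows m x D D' (λ j → refl) (λ i j → refl) ⟨
    det (suc m) D'
      ≈⟨ det-first-column m D' column≈0 ⟩
    (1# * 1#) * det m (minor zero D')
      ≈⟨ trans (*-congʳ (*-identityˡ 1#)) (*-identityˡ _) ⟩
    det m (minor zero D')
      ≈⟨ det-cong m block ⟩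
    det m (theMatrix m c) ∎
    where
    x : Carrier
    x = c zero
    D D' : Matrix (suc m)
    D = bordered m c
    D' zero    j = D zero j
    D' (suc i) j = D (suc i) j + x * D (inject₁ i) j
    column≈0 : ∀ i → D' (suc i) zero ≈ 0#
    column≈0 i = begin
      - sgn (toℕ i) * (x * x ^ toℕ i) + x * (sgn (toℕ (inject₁ i)) * x ^ toℕ (inject₁ i))
        ≡⟨ ≡.cong (λ t → - sgn (toℕ i) * (x * x ^ toℕ i) + x * (sgn t * x ^ t)) (toℕ-inject₁ i) ⟩
      - sgn (toℕ i) * (x * x ^ toℕ i) + x * (sgn (toℕ i) * x ^ toℕ i)
        ≈⟨ +-congʳ (sym (-‿distribˡ-* _ _)) ⟩
      - (sgn (toℕ i) * (x * x ^ toℕ i)) + x * (sgn (toℕ i) * x ^ toℕ i)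
        ≈⟨ neg-cancel (solve 3 (λ s x p → s :* (x :* p) := x :* (s :* p)) refl (sgn (toℕ i)) x (x ^ toℕ i)) ⟩
      0# ∎
    block : ∀ i k → minor zero D' i k ≈ theMatrix m c i k
    block i k = begin
      entry m (c ∘ suc) (suc (toℕ i)) (toℕ k) + x * entry m (c ∘ suc) (toℕ (inject₁ i)) (toℕ k)
        ≡⟨ ≡.cong (λ t → entry m (c ∘ suc) (suc (toℕ i)) (toℕ k) + x * entry m (c ∘ suc) t (toℕ k))
                  (toℕ-inject₁ i) ⟩
      entry m (c ∘ suc) (suc (toℕ i)) (toℕ k) + x * entry m (c ∘ suc) (toℕ i) (toℕ k)
        ≈⟨ entry-step m c (toℕ i) (toℕ k) ⟨
      entry (suc m) c (suc (toℕ i)) (toℕ k)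
        ≈⟨ theMatrix-entry m c i k ⟨
      theMatrix m c i k ∎

  -- Adding to row 0 the combination Σ_k (-1)^k e_k(d) (row k) makes row 0
  -- equal to (Π_j (1 + c_0 d_j), 0, …, 0) by the generating function and the
  -- annihilation identity; the remaining block has last column (0, …, 0, 1)
  -- and upper-left block the matrix of the theorem for d.
  bordered-det-reduce : ∀ n (c : Fin (suc (suc n)) → Carrier) →
                        det (suc (suc n)) (bordered (suc n) c) ≈
                        prodF (suc n) (λ j → 1# + c zero * c (suc j)) * det n (theMatrix n (c ∘ suc))
  bordered-det-reduce n c = begin
    det (suc m) D
      ≈⟨ det-add-combination m y D D^ (λ j → refl) (λ i j → refl) ⟨
    det (suc m) D^
      ≈⟨ det-first-row m D^ row≈0 ⟩
    D^ zero zero * det m (minor zero D^)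
      ≈⟨ *-cong corner (det-last-column n (minor zero D^) column≈0 corner≈1) ⟩
    prodF m (λ j → 1# + x * d j) * det n (λ i k → minor zero D^ (inject₁ i) (inject₁ k))
      ≈⟨ *-congˡ (det-cong n block) ⟩
    prodF m (λ j → 1# + x * d j) * det n (theMatrix n d) ∎
    where
    m : ℕ
    m = suc n
    x : Carrier
    x = c zero
    d : Fin m → Carrier
    d = c ∘ suc
    e : ℕ → Carrier
    e = esym m d
    y : Fin m → Carrier
    y k = sgn (suc (toℕ k)) * e (suc (toℕ k))
    D D^ : Matrix (suc m)
    D = bordered m c
    D^ = withRow0 (λ j → D zero j + sumF m (λ k → y k * D (suc k) j)) D

    row≈0 : ∀ j → D^ zero (suc j) ≈ 0#
    row≈0 j = trans (+-congʳ (sym (trans (*-congʳ (*-identityˡ 1#)) (*-identityˡ _))))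
                    (esym-annihilates m d (toℕ j))
    corner : D^ zero zero ≈ prodF m (λ j → 1# + x * d j)
    corner = trans (+-congˡ (sumF-cong m (λ k → signs-cancel (suc (toℕ k)) (e (suc (toℕ k))) (x ^ suc (toℕ k)))))
                   (esym-generating x m d)
    column≈0 : ∀ i → minor zero D^ (inject₁ i) (fromℕ n) ≈ 0#
    column≈0 i = begin
      entry m d (suc (toℕ (inject₁ i))) (toℕ (fromℕ n))
        ≡⟨ ≡.cong₂ (λ k j → entry m d (suc k) j) (toℕ-inject₁ i) (toℕ-fromℕ n) ⟩
      entry m d (suc (toℕ i)) n
        ≈⟨ entry-above m d (toℕ<n i) (s≤s (ℕₚ.m≤n+m (suc n) (toℕ i))) ⟩
      0# ∎
    corner≈1 : minor zero D^ (fromℕ n) (fromℕ n) ≈ 1#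
    corner≈1 = trans (reflexive (≡.cong (λ j → entry m d (suc j) j) (toℕ-fromℕ n))) (entry-diagonal n d)
    block : ∀ i k → minor zero D^ (inject₁ i) (inject₁ k) ≈ theMatrix n d i k
    block i k = begin
      entry m d (suc (toℕ (inject₁ i))) (toℕ (inject₁ k))
        ≡⟨ ≡.cong₂ (λ i k → entry m d (suc i) k) (toℕ-inject₁ i) (toℕ-inject₁ k) ⟩
      entry m d (suc (toℕ i)) (toℕ k)
        ≈⟨ theMatrix-entry n d i k ⟨
      theMatrix n d i k ∎

  det-theMatrix-step : ∀ n (c : Fin (suc (suc n)) → Carrier) →
                       det (suc n) (theMatrix (suc n) c) ≈
                       prodF (suc n) (λ j → 1# + c zero * c (suc j)) * det n (theMatrix n (c ∘ suc))
  det-theMatrix-step n c = trans (sym (bordered-det-shift (suc n) c)) (bordered-det-reduce n c)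

lemmaA3 : {a ℓ : Level} (R : CommutativeRing a ℓ) (n : ℕ)
          (c : Fin (suc n) → CommutativeRing.Carrier R) →
          CommutativeRing._≈_ R (WithRing.det R n (WithRing.theMatrix R n c))
                                (WithRing.pairProd R (suc n) c)
lemmaA3 R zero    c = sym (*-identityˡ 1#)
  where open CommutativeRing R
lemmaA3 R (suc n) c = trans (det-theMatrix-step n c) (*-congˡ (lemmaA3 R n (c ∘ suc)))
  where open CommutativeRing R hiding (zero)
        open Proof R
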